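{- Let $n\ge 1$ and let $1<p_1<\cdots<p_{n+1}$ be prime integers. Then: (a) $$g\left(\frac{p_1\cdots p_{n+1}}{p_{n+1}},\dots,\frac{p_1\cdots p_{n+1}}{p_1}\right)=n\prod_{i=1}^{n+1}p_i-\sum_{i=1}^{n+1}\frac{p_1\cdots p_{n+1}}{p_i}.$$ (b) For each $k=1,\dots,n$ and all $\{i_1<\dots<i_{k+1}\}\subseteq\{1,\dots,n+1\}$, $$g\left(\frac{p_{n-k+1}\cdots p_{n+1}}{p_{n+1}},\dots,\frac{p_{n-k+1}\cdots p_{n+1}}{p_{n-k+1}}\right)\ge g\left(\frac{p_{i_1}\cdots p_{i_{k+1}}}{p_{i_{k+1}}},\dots,\frac{p_{i_1}\cdots p_{i_{k+1}}}{p_{i_1}}\right),$$ with equality if and only if $\{i_1,\dots,i_{k+1}\}=\{n-k+1,\dots,n+1\}$.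
   Context: For positive integers $s_1,\dots,s_m$ with $\gcd(s_1,\dots,s_m)=1$, the Frobenius number $g(s_1,\dots,s_m)$ is the largest integer that is not representable as a nonnegative integer combination of $s_1,\dots,s_m$. The arguments in each $g(\cdot)$ above are the products of the listed primes with one factor omitted. -}

module Defs where

open import Data.Nat using (ℕ; zero; suc; _+_; _*_)
open import Data.Fin using (Fin; zero; suc; punchIn)
open import Data.Integer using (ℤ; +_; _<_)
open import Data.Product using (Σ; _×_)
open import Relation.Binary.PropositionalEquality using (_≡_)
open import Relation.Nullary using (¬_)

prodF : (m : ℕ) → (Fin m → ℕ) → ℕ
prodF zero    f = 1
prodF (suc m) f = f zero * prodF m (λ i → f (suc i))

sumF : (m : ℕ) → (Fin m → ℕ) → ℕ
sumF zero    f = 0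
sumF (suc m) f = f zero + sumF m (λ i → f (suc i))

-- product of q_0,…,q_m with the factor q_j omitted  (= (q_0⋯q_m)/q_j)
prodOmit : (m : ℕ) → (Fin (suc m) → ℕ) → Fin (suc m) → ℕ
prodOmit m q j = prodF m (λ i → q (punchIn j i))

Representable : (m : ℕ) → (Fin m → ℕ) → ℤ → Set
Representable m s z = Σ (Fin m → ℕ) (λ c → z ≡ + sumF m (λ i → c i * s i))

IsFrobenius : (m : ℕ) → (Fin m → ℕ) → ℤ → Set
IsFrobenius m s g = ¬ Representable m s g × ((z : ℤ) → g < z → Representable m s z)

open import Data.Nat using (_≤_; _∸_; s≤s) renaming (_<_ to _<ℕ_)
open import Data.Nat.Properties using (+-monoʳ-≤; m∸n+n≡m; ≤-trans; ≤-reflexive)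
open import Data.Fin using (toℕ; fromℕ<)
open import Data.Fin.Properties using (toℕ≤pred[n])

-- the index j ∈ {0,…,k} ↦ (n−k)+j ∈ {0,…,n}, i.e. the top k+1 indices (0-based)
topIdx : (n k : ℕ) → k ≤ n → Fin (suc k) → Fin (suc n)
topIdx n k k≤n j = fromℕ< {(n ∸ k) + toℕ j} (s≤s (≤-trans (+-monoʳ-≤ (n ∸ k) (toℕ≤pred[n] j))
                                            (≤-reflexive (m∸n+n≡m k≤n))))

-- Write P = q₀⋯qₘ, sᵢ = P/qᵢ and E = Σ sᵢ.  If Σ cᵢsᵢ + E = mP, then qⱼ divides every sᵢ
-- with i ≠ j and mP, hence (cⱼ + 1)sⱼ and so cⱼ + 1; summing qⱼsⱼ ≤ (cⱼ + 1)sⱼ gives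
-- (m + 1)P ≤ mP.  For n > mP − E choose cᵢ < qᵢ with cᵢsᵢ ≡ n (mod qᵢ): then T = Σ cᵢsᵢ is
-- congruent to n modulo every qᵢ, hence modulo P, and T < n + P, so n − T is a nonnegative
-- multiple of P = q₀s₀.  For (b), mP − E + 1 obeys a recursion in the first prime which makes
-- it strictly increasing in each qᵢ ≥ 2, and any strictly increasing choice of k + 1 of the
-- primes is termwise dominated by the top k + 1.

module Submission where

open import Defs
open import Data.Nat using (ℕ; suc; _+_; _*_; _∸_; _≤_; _<_)
open import Data.Fin using (Fin; toℕ)
open import Data.Fin.Base using () renaming (_<_ to _<ᶠ_)
open import Data.Nat.Primality using (Prime)
open import Data.Integer using (ℤ; +_; _-_) renaming (_≤_ to _≤ℤ_)
open import Data.Product using (Σ; _×_)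
open import Relation.Binary.PropositionalEquality using (_≡_)
open import Function.Bundles using (_⇔_)

open import Data.Nat.Base
  using (zero; pred; NonZero; >-nonZero; z≤n; s≤s; s≤s⁻¹; nonTrivial⇒n>1; nonTrivial⇒≢1)
open import Data.Nat.Properties hiding (suc-injective)
open import Data.Nat.Divisibility
open import Data.Nat.DivMod
  using (_%_; _/_; m≡m%n+[m/n]*n; m%n%n≡m%n; m%n<n; [m+kn]%n≡m%n; %-distribˡ-*; %-remove-+ʳ)
open import Data.Nat.Primality using (prime⇒nonZero; prime⇒nonTrivial; prime⇒irreducible; euclidsLemma)
open import Data.Nat.Coprimality using (Coprime; coprime-Bézout; coprime-divisor)
open import Data.Nat.GCD using (module Bézout)
open import Data.Nat.Tactic.RingSolver using (solve-∀)
open import Data.Fin using (zero; suc; punchIn; punchOut)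
open import Data.Fin.Properties
  using (suc-injective; toℕ-injective; toℕ-fromℕ<; toℕ≤pred[n]; punchIn-punchOut; punchInᵢ≢i)
  renaming (<-cmp to <ᶠ-cmp)
open import Data.Integer using (+<+; _⊖_) renaming (_<_ to _<ℤ_)
import Data.Integer.Properties as ℤ
open import Data.Product using (_,_; proj₁; proj₂; ∃)
open import Data.Sum using (inj₁; inj₂)
open import Data.Empty using (⊥-elim)
open import Function.Base using (_∘_)
open import Function.Bundles using (mk⇔)
open import Function.Definitions using (Injective)
open import Relation.Nullary using (¬_; yes; no; contradiction)
open import Relation.Binary.Definitions using (tri<; tri≈; tri>)
open import Relation.Binary.PropositionalEquality
  using (_≢_; refl; sym; trans; cong; cong₂; subst; subst₂; module ≡-Reasoning)

-- Finite sums and products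

sumF-cong : ∀ m {f g : Fin m → ℕ} → (∀ i → f i ≡ g i) → sumF m f ≡ sumF m g
sumF-cong zero    f≗g = refl
sumF-cong (suc m) f≗g = cong₂ _+_ (f≗g zero) (sumF-cong m (f≗g ∘ suc))

sumF-mono-≤ : ∀ m {f g : Fin m → ℕ} → (∀ i → f i ≤ g i) → sumF m f ≤ sumF m g
sumF-mono-≤ zero    f≤g = z≤n
sumF-mono-≤ (suc m) f≤g = +-mono-≤ (f≤g zero) (sumF-mono-≤ m (f≤g ∘ suc))

sumF-+ : ∀ m (f g : Fin m → ℕ) → sumF m (λ i → f i + g i) ≡ sumF m f + sumF m g
sumF-+ zero    f g = refl
sumF-+ (suc m) f g = begin
  f zero + g zero + sumF m (λ i → f (suc i) + g (suc i))
    ≡⟨ cong (λ t → f zero + g zero + t) (sumF-+ m (f ∘ suc) (g ∘ suc)) ⟩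
  f zero + g zero + (sumF m (f ∘ suc) + sumF m (g ∘ suc))
    ≡⟨ +-assoc-comm (f zero) (g zero) (sumF m (f ∘ suc)) (sumF m (g ∘ suc)) ⟩
  f zero + sumF m (f ∘ suc) + (g zero + sumF m (g ∘ suc)) ∎
  where
  open ≡-Reasoning
  +-assoc-comm : ∀ a b c d → a + b + (c + d) ≡ a + c + (b + d)
  +-assoc-comm = solve-∀

sumF-*ˡ : ∀ m a (f : Fin m → ℕ) → sumF m (λ i → a * f i) ≡ a * sumF m f
sumF-*ˡ zero    a f = sym (*-zeroʳ a)
sumF-*ˡ (suc m) a f = trans (cong (λ t → a * f zero + t) (sumF-*ˡ m a (f ∘ suc)))
                            (sym (*-distribˡ-+ a (f zero) (sumF m (f ∘ suc))))

sumF-const : ∀ m a → sumF m (λ _ → a) ≡ m * a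
sumF-const zero    a = refl
sumF-const (suc m) a = cong (λ t → a + t) (sumF-const m a)

sumF-∣ : ∀ m {d} (f : Fin m → ℕ) → (∀ i → d ∣ f i) → d ∣ sumF m f
sumF-∣ zero    f d∣f = _ ∣0
sumF-∣ (suc m) f d∣f = ∣m∣n⇒∣m+n (d∣f zero) (sumF-∣ m (f ∘ suc) (d∣f ∘ suc))

sumF-punchIn : ∀ m (f : Fin (suc m) → ℕ) j → sumF (suc m) f ≡ f j + sumF m (f ∘ punchIn j)
sumF-punchIn m       f zero    = refl
sumF-punchIn (suc m) f (suc j) =
  trans (cong (λ t → f zero + t) (sumF-punchIn m (f ∘ suc) j)) (x+[y+z]≡y+[x+z] (f zero) (f (suc j)) _)
  where
  x+[y+z]≡y+[x+z] : ∀ x y z → x + (y + z) ≡ y + (x + z)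
  x+[y+z]≡y+[x+z] = solve-∀

prodF-punchIn : ∀ m (f : Fin (suc m) → ℕ) j → prodF (suc m) f ≡ f j * prodF m (f ∘ punchIn j)
prodF-punchIn m       f zero    = refl
prodF-punchIn (suc m) f (suc j) =
  trans (cong (f zero *_) (prodF-punchIn m (f ∘ suc) j)) (x*[y*z]≡y*[x*z] (f zero) (f (suc j)) _)
  where
  x*[y*z]≡y*[x*z] : ∀ x y z → x * (y * z) ≡ y * (x * z)
  x*[y*z]≡y*[x*z] = solve-∀

prodF-mono-≤ : ∀ m {f g : Fin m → ℕ} → (∀ i → f i ≤ g i) → prodF m f ≤ prodF m g
prodF-mono-≤ zero    f≤g = ≤-refl
prodF-mono-≤ (suc m) f≤g = *-mono-≤ (f≤g zero) (prodF-mono-≤ m (f≤g ∘ suc))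

prodF-positive : ∀ m {f : Fin m → ℕ} → (∀ i → 1 ≤ f i) → 1 ≤ prodF m f
prodF-positive zero    f≥1 = ≤-refl
prodF-positive (suc m) f≥1 = *-mono-≤ (f≥1 zero) (prodF-positive m (f≥1 ∘ suc))

prodF-mono-< : ∀ m {f g : Fin m → ℕ} → (∀ i → 1 ≤ f i) → (∀ i → f i ≤ g i) →
               ∀ j → f j < g j → prodF m f < prodF m g
prodF-mono-< (suc m) {f} {g} f≥1 f≤g zero fj<gj =
  <-≤-trans (*-monoˡ-< (prodF m (f ∘ suc)) {{>-nonZero (prodF-positive m (f≥1 ∘ suc))}} fj<gj)
            (*-monoʳ-≤ (g zero) (prodF-mono-≤ m (f≤g ∘ suc)))
prodF-mono-< (suc m) {f} {g} f≥1 f≤g (suc j) fj<gj =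
  ≤-<-trans (*-monoˡ-≤ (prodF m (f ∘ suc)) (f≤g zero))
            (*-monoʳ-< (g zero) {{>-nonZero (≤-trans (f≥1 zero) (f≤g zero))}}
                       (prodF-mono-< m (f≥1 ∘ suc) (f≤g ∘ suc) j fj<gj))

∣prodF : ∀ m (f : Fin m → ℕ) j → f j ∣ prodF m f
∣prodF (suc m) f zero    = m∣m*n _
∣prodF (suc m) f (suc j) = ∣-trans (∣prodF m (f ∘ suc) j) (n∣m*n (f zero))

-- Primes

prime⇒≥2 : ∀ {p} → Prime p → 2 ≤ p
prime⇒≥2 {p} p-prime = nonTrivial⇒n>1 p {{prime⇒nonTrivial p-prime}}

prime∣prime⇒≡ : ∀ {p r} → Prime p → Prime r → p ∣ r → p ≡ r
prime∣prime⇒≡ p-prime r-prime p∣r with prime⇒irreducible r-prime p∣r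
... | inj₁ p≡1 = ⊥-elim (nonTrivial⇒≢1 {{prime⇒nonTrivial p-prime}} p≡1)
... | inj₂ p≡r = p≡r

prime∣prodF⇒∣ : ∀ m {p} (f : Fin m → ℕ) → Prime p → p ∣ prodF m f → ∃ λ j → p ∣ f j
prime∣prodF⇒∣ zero    f p-prime p∣1 = ⊥-elim (nonTrivial⇒≢1 {{prime⇒nonTrivial p-prime}} (∣1⇒≡1 p∣1))
prime∣prodF⇒∣ (suc m) f p-prime p∣f with euclidsLemma (f zero) (prodF m (f ∘ suc)) p-prime p∣f
... | inj₁ p∣f₀ = zero , p∣f₀
... | inj₂ p∣tail with prime∣prodF⇒∣ m (f ∘ suc) p-prime p∣tail
...   | j , p∣fⱼ = suc j , p∣fⱼ

prime∤⇒coprime : ∀ {p n} → Prime p → p ∤ n → Coprime p n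
prime∤⇒coprime p-prime p∤n (d∣p , d∣n) with prime⇒irreducible p-prime d∣p
... | inj₁ d≡1    = d≡1
... | inj₂ refl = ⊥-elim (p∤n d∣n)

∣prodOmit : ∀ m (q : Fin (suc m) → ℕ) {i j} → i ≢ j → q j ∣ prodOmit m q i
∣prodOmit m q {i} i≢j = subst (λ k → q k ∣ prodOmit m q i) (punchIn-punchOut i≢j)
                               (∣prodF m (q ∘ punchIn i) (punchOut i≢j))

∤prodOmit : ∀ m {q : Fin (suc m) → ℕ} → (∀ i → Prime (q i)) → Injective _≡_ _≡_ q →
            ∀ j → q j ∤ prodOmit m q j
∤prodOmit m {q} prime q-injective j qⱼ∣ with prime∣prodF⇒∣ m (q ∘ punchIn j) (prime j) qⱼ∣
... | i , qⱼ∣qᵢ =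
  punchInᵢ≢i j i (sym (q-injective (prime∣prime⇒≡ (prime j) (prime (punchIn j i)) qⱼ∣qᵢ)))

prodF-∣ : ∀ m {f : Fin m → ℕ} {n} → (∀ i → Prime (f i)) → Injective _≡_ _≡_ f →
          (∀ i → f i ∣ n) → prodF m f ∣ n
prodF-∣ zero    prime f-injective f∣n = 1∣ _
prodF-∣ (suc m) {f} prime f-injective f∣n
  with prodF-∣ m (prime ∘ suc) (suc-injective ∘ f-injective) (f∣n ∘ suc)
... | divides t n≡t*tail
  with coprime-divisor (prime∤⇒coprime (prime zero) (∤prodOmit m prime f-injective zero))
                       (subst (f zero ∣_) (trans n≡t*tail (*-comm t _)) (f∣n zero))
... | divides u t≡u*f₀ = divides u (trans n≡t*tail (trans (cong (_* prodF m (f ∘ suc)) t≡u*f₀)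
                                                          (*-assoc u (f zero) _)))

-- Congruences

[m%d*n]%d≡[m*n]%d : ∀ m n d .{{_ : NonZero d}} → (m % d * n) % d ≡ (m * n) % d
[m%d*n]%d≡[m*n]%d m n d = begin
  (m % d * n) % d            ≡⟨ %-distribˡ-* (m % d) n d ⟩
  (m % d % d * (n % d)) % d  ≡⟨ cong (λ t → (t * (n % d)) % d) (m%n%n≡m%n m d) ⟩
  (m % d * (n % d)) % d      ≡⟨ sym (%-distribˡ-* m n d) ⟩
  (m * n) % d                ∎
  where open ≡-Reasoning

%≡%⇒∣∸ : ∀ m n d .{{_ : NonZero d}} → m % d ≡ n % d → d ∣ n ∸ m
%≡%⇒∣∸ m n d m%d≡n%d = divides (n / d ∸ m / d) (begin
  n ∸ m                                ≡⟨ cong₂ _∸_ (m≡m%n+[m/n]*n n d) (m≡m%n+[m/n]*n m d) ⟩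
  (n % d + n / d * d) ∸ (m % d + m / d * d) ≡⟨ cong (λ t → (n % d + n / d * d) ∸ (t + m / d * d)) m%d≡n%d ⟩
  (n % d + n / d * d) ∸ (n % d + m / d * d) ≡⟨ [m+n]∸[m+o]≡n∸o (n % d) (n / d * d) (m / d * d) ⟩
  n / d * d ∸ m / d * d                ≡⟨ sym (*-distribʳ-∸ d (n / d) (m / d)) ⟩
  (n / d ∸ m / d) * d                  ∎)
  where open ≡-Reasoning

∣∸∧<⇒≤ : ∀ {m n d} → d ∣ m ∸ n → m < n + d → m ≤ n
∣∸∧<⇒≤ {m} {n} {d} d∣m∸n m<n+d with m ≤? n
... | yes m≤n = m≤n
... | no  m≰n = ⊥-elim (<⇒≱ m<n+d (begin
  n + d       ≤⟨ +-monoʳ-≤ n (∣⇒≤ {{>-nonZero (m<n⇒0<n∸m (≰⇒> m≰n))}} d∣m∸n) ⟩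
  n + (m ∸ n) ≡⟨ m+[n∸m]≡n (<⇒≤ (≰⇒> m≰n)) ⟩
  m           ∎))
  where open ≤-Reasoning

∃-inverse-% : ∀ {d s} .{{_ : NonZero d}} → Coprime d s → ∃ λ x → (x * s) % d ≡ 1 % d
∃-inverse-% {suc d′} {s} d⊥s with coprime-Bézout d⊥s
... | Bézout.-+ x y 1+xd≡ys = y , (begin
  (y * s) % d      ≡⟨ cong (_% d) (sym 1+xd≡ys) ⟩
  (1 + x * d) % d  ≡⟨ [m+kn]%n≡m%n 1 x d ⟩
  1 % d            ∎)
  where
  open ≡-Reasoning
  d = suc d′
... | Bézout.+- x y 1+ys≡xd = d′ * y , (begin
  (d′ * y * s) % d                 ≡⟨ sym ([m+kn]%n≡m%n (d′ * y * s) 1 d) ⟩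
  (d′ * y * s + 1 * d) % d         ≡⟨ cong (_% d) (sym (shift d′ y s)) ⟩
  (1 + d′ * (1 + y * s)) % d       ≡⟨ cong (λ t → (1 + d′ * t) % d) 1+ys≡xd ⟩
  (1 + d′ * (x * d)) % d           ≡⟨ cong (λ t → (1 + t) % d) (sym (*-assoc d′ x d)) ⟩
  (1 + d′ * x * d) % d             ≡⟨ [m+kn]%n≡m%n 1 (d′ * x) d ⟩
  1 % d                            ∎)
  where
  open ≡-Reasoning
  d = suc d′
  shift : ∀ d′ y s → 1 + d′ * (1 + y * s) ≡ d′ * y * s + 1 * suc d′
  shift = solve-∀

∃-solution-% : ∀ {d s} .{{_ : NonZero d}} → Coprime d s → ∀ n → ∃ λ c → c < d × (c * s) % d ≡ n % d
∃-solution-% {d} {s} d⊥s n with ∃-inverse-% d⊥s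
... | x , xs≡1 = (n * x) % d , m%n<n (n * x) d , (begin
  ((n * x) % d * s) % d         ≡⟨ [m%d*n]%d≡[m*n]%d (n * x) s d ⟩
  (n * x * s) % d               ≡⟨ cong (_% d) (*-assoc n x s) ⟩
  (n * (x * s)) % d             ≡⟨ %-distribˡ-* n (x * s) d ⟩
  (n % d * ((x * s) % d)) % d   ≡⟨ cong (λ t → (n % d * t) % d) xs≡1 ⟩
  (n % d * (1 % d)) % d         ≡⟨ sym (%-distribˡ-* n 1 d) ⟩
  (n * 1) % d                   ≡⟨ cong (_% d) (*-identityʳ n) ⟩
  n % d                         ∎)
  where open ≡-Reasoning

-- The conductor

frobeniusFormula : (m : ℕ) → (Fin (suc m) → ℕ) → ℤ
frobeniusFormula m q = + (m * prodF (suc m) q) - + sumF (suc m) (prodOmit m q)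

-- Johnson's reduction g(x·a₁, …, x·aₘ, b) = x·g(a₁, …, aₘ) + (x − 1)·b, shifted to g + 1.
conductor : (m : ℕ) → (Fin (suc m) → ℕ) → ℕ
conductor zero    q = 0
conductor (suc m) q = q zero * conductor m (q ∘ suc) + pred (q zero) * pred (prodF (suc m) (q ∘ suc))

conductor+sumF-prodOmit : ∀ m {q : Fin (suc m) → ℕ} → (∀ i → 1 ≤ q i) →
                          conductor m q + sumF (suc m) (prodOmit m q) ≡ suc (m * prodF (suc m) q)
conductor+sumF-prodOmit zero    q≥1 = refl
conductor+sumF-prodOmit (suc m) {q} q≥1 = begin
  x * C + pred x * pred P + (P + sumF (suc m) (λ i → x * prodOmit m (q ∘ suc) i))
    ≡⟨ cong (λ t → x * C + pred x * pred P + (P + t)) (sumF-*ˡ (suc m) x (prodOmit m (q ∘ suc))) ⟩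
  x * C + pred x * pred P + (P + x * E)
    ≡⟨ regroup x C E (pred x * pred P) P ⟩
  x * (C + E) + (pred x * pred P + P)
    ≡⟨ cong (λ t → x * t + (pred x * pred P + P)) (conductor+sumF-prodOmit m (q≥1 ∘ suc)) ⟩
  x * suc (m * P) + (pred x * pred P + P)
    ≡⟨ expand (q≥1 zero) (prodF-positive (suc m) (q≥1 ∘ suc)) ⟩
  suc (suc m * (x * P)) ∎
  where
  open ≡-Reasoning
  x = q zero
  C = conductor m (q ∘ suc)
  P = prodF (suc m) (q ∘ suc)
  E = sumF (suc m) (prodOmit m (q ∘ suc))
  regroup : ∀ x C E y P → x * C + y + (P + x * E) ≡ x * (C + E) + (y + P)
  regroup = solve-∀
  expand : ∀ {x P} → 1 ≤ x → 1 ≤ P → x * suc (m * P) + (pred x * pred P + P) ≡ suc (suc m * (x * P))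
  expand {suc x} {suc P} _ _ = identity m x P
    where
    identity : ∀ m x P → suc x * suc (m * suc P) + (x * P + suc P) ≡ suc (suc m * (suc x * suc P))
    identity = solve-∀

2≤prodF : ∀ m {f : Fin (suc m) → ℕ} → (∀ i → 2 ≤ f i) → 2 ≤ prodF (suc m) f
2≤prodF m f≥2 = *-mono-≤ (f≥2 zero) (prodF-positive m (<⇒≤ ∘ f≥2 ∘ suc))

conductor-positive : ∀ m {q : Fin (suc (suc m)) → ℕ} → (∀ i → 2 ≤ q i) → 1 ≤ conductor (suc m) q
conductor-positive m q≥2 =
  ≤-trans (*-mono-≤ (pred-mono-≤ (q≥2 zero)) (pred-mono-≤ (2≤prodF m (q≥2 ∘ suc)))) (m≤n+m _ _)

conductor-mono-≤ : ∀ m {q′ q : Fin (suc m) → ℕ} → (∀ i → q′ i ≤ q i) → conductor m q′ ≤ conductor m q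
conductor-mono-≤ zero    q′≤q = z≤n
conductor-mono-≤ (suc m) q′≤q =
  +-mono-≤ (*-mono-≤ (q′≤q zero) (conductor-mono-≤ m (q′≤q ∘ suc)))
           (*-mono-≤ (pred-mono-≤ (q′≤q zero)) (pred-mono-≤ (prodF-mono-≤ (suc m) (q′≤q ∘ suc))))

conductor-mono-< : ∀ m {q′ q : Fin (suc (suc m)) → ℕ} → (∀ i → 2 ≤ q′ i) → (∀ i → q′ i ≤ q i) →
                   ∀ j → q′ j < q j → conductor (suc m) q′ < conductor (suc m) q
conductor-mono-< m {q′} {q} q′≥2 q′≤q j q′ⱼ<qⱼ =
  +-mono-≤-< (*-mono-≤ (q′≤q zero) (conductor-mono-≤ m (q′≤q ∘ suc))) (pred*pred-mono-< j q′ⱼ<qⱼ)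
  where
  P′ = prodF (suc m) (q′ ∘ suc)
  P = prodF (suc m) (q ∘ suc)
  pred-nonZero : ∀ {n} → 2 ≤ n → NonZero (pred n)
  pred-nonZero n≥2 = >-nonZero (pred-mono-≤ n≥2)
  pred*pred-mono-< : ∀ j → q′ j < q j → pred (q′ zero) * pred P′ < pred (q zero) * pred P
  pred*pred-mono-< zero q′₀<q₀ =
    <-≤-trans (*-monoˡ-< (pred P′) {{pred-nonZero (2≤prodF m (q′≥2 ∘ suc))}}
                         (pred-mono-< {{>-nonZero (<⇒≤ (q′≥2 zero))}} q′₀<q₀))
              (*-monoʳ-≤ (pred (q zero)) (pred-mono-≤ (prodF-mono-≤ (suc m) (q′≤q ∘ suc))))
  pred*pred-mono-< (suc j) q′ⱼ<qⱼ =
    ≤-<-trans (*-monoˡ-≤ (pred P′) (pred-mono-≤ (q′≤q zero)))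
              (*-monoʳ-< (pred (q zero)) {{pred-nonZero (≤-trans (q′≥2 zero) (q′≤q zero))}}
                         (pred-mono-< {{>-nonZero (<⇒≤ (2≤prodF m (q′≥2 ∘ suc)))}}
                                      (prodF-mono-< (suc m) (<⇒≤ ∘ q′≥2 ∘ suc) (q′≤q ∘ suc) j q′ⱼ<qⱼ)))

frobeniusFormula≡conductor⊖1 : ∀ m {q : Fin (suc m) → ℕ} → (∀ i → 1 ≤ q i) →
                               frobeniusFormula m q ≡ conductor m q ⊖ 1
frobeniusFormula≡conductor⊖1 m {q} q≥1 = begin
  + (m * P) - + E      ≡⟨ ℤ.[+m]-[+n]≡m⊖n (m * P) E ⟩
  m * P ⊖ E            ≡⟨ sym (ℤ.[1+m]⊖[1+n]≡m⊖n (m * P) E) ⟩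
  suc (m * P) ⊖ suc E  ≡⟨ cong₂ _⊖_ (sym (conductor+sumF-prodOmit m q≥1)) (+-comm 1 E) ⟩
  (C + E) ⊖ (E + 1)    ≡⟨ cong (_⊖ (E + 1)) (+-comm C E) ⟩
  (E + C) ⊖ (E + 1)    ≡⟨ ℤ.+-cancelˡ-⊖ E C 1 ⟩
  C ⊖ 1                ∎
  where
  open ≡-Reasoning
  P = prodF (suc m) q
  E = sumF (suc m) (prodOmit m q)
  C = conductor m q

frobeniusFormula-mono-≤ : ∀ m {q′ q : Fin (suc m) → ℕ} → (∀ i → 1 ≤ q′ i) → (∀ i → q′ i ≤ q i) →
                          frobeniusFormula m q′ ≤ℤ frobeniusFormula m q
frobeniusFormula-mono-≤ m q′≥1 q′≤q =
  subst₂ _≤ℤ_ (sym (frobeniusFormula≡conductor⊖1 m q′≥1))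
              (sym (frobeniusFormula≡conductor⊖1 m (λ i → ≤-trans (q′≥1 i) (q′≤q i))))
              (ℤ.⊖-monoˡ-≤ 1 (conductor-mono-≤ m q′≤q))

frobeniusFormula-mono-< : ∀ m {q′ q : Fin (suc (suc m)) → ℕ} →
                          (∀ i → 2 ≤ q′ i) → (∀ i → q′ i ≤ q i) →
                          ∀ j → q′ j < q j → frobeniusFormula (suc m) q′ <ℤ frobeniusFormula (suc m) q
frobeniusFormula-mono-< m q′≥2 q′≤q j q′ⱼ<qⱼ =
  subst₂ _<ℤ_ (sym (frobeniusFormula≡conductor⊖1 (suc m) (<⇒≤ ∘ q′≥2)))
              (sym (frobeniusFormula≡conductor⊖1 (suc m) (λ i → <⇒≤ (≤-trans (q′≥2 i) (q′≤q i)))))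
              (ℤ.⊖-monoˡ-< 1 (conductor-mono-< m q′≥2 q′≤q j q′ⱼ<qⱼ))

-- Frobenius numbers

isFrobenius-⊖ : ∀ {m} {s : Fin m → ℕ} {a b} → b ≤ a →
                (∀ c → sumF m (λ i → c i * s i) + b ≢ a) →
                (∀ n → a < n + b → Representable m s (+ n)) →
                IsFrobenius m s (+ a - + b)
isFrobenius-⊖ {m} {s} {a} {b} b≤a notRep rep
  rewrite ℤ.[+m]-[+n]≡m⊖n a b | ℤ.⊖-≥ b≤a = a∸b-notRep , above-a∸b-rep
  where
  a∸b-notRep : ¬ Representable m s (+ (a ∸ b))
  a∸b-notRep (c , a∸b≡Σcs) = notRep c (trans (cong (_+ b) (sym (ℤ.+-injective a∸b≡Σcs))) (m∸n+n≡m b≤a))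
  above-a∸b-rep : ∀ z → + (a ∸ b) <ℤ z → Representable m s z
  above-a∸b-rep (+ n) (+<+ a∸b<n) = rep n (subst (_< n + b) (m∸n+n≡m b≤a) (+-monoˡ-< b a∸b<n))

sumF-*prodOmit : ∀ m (q : Fin (suc m) → ℕ) →
                 sumF (suc m) (λ i → q i * prodOmit m q i) ≡ suc m * prodF (suc m) q
sumF-*prodOmit m q = trans (sumF-cong (suc m) (λ i → sym (prodF-punchIn m q i))) (sumF-const (suc m) _)

sumF-*prodOmit-% : ∀ m (q c : Fin (suc m) → ℕ) j .{{_ : NonZero (q j)}} →
                   sumF (suc m) (λ i → c i * prodOmit m q i) % q j ≡ (c j * prodOmit m q j) % q j
sumF-*prodOmit-% m q c j =
  trans (cong (_% q j) (sumF-punchIn m (λ i → c i * prodOmit m q i) j))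
        (%-remove-+ʳ _ (sumF-∣ m (λ i → c (punchIn j i) * prodOmit m q (punchIn j i)) qⱼ∣cᵢsᵢ))
  where
  qⱼ∣cᵢsᵢ : ∀ i → q j ∣ c (punchIn j i) * prodOmit m q (punchIn j i)
  qⱼ∣cᵢsᵢ i = ∣-trans (∣prodOmit m q (punchInᵢ≢i j i)) (n∣m*n (c (punchIn j i)))

module _ {m} {q : Fin (suc m) → ℕ} (prime : ∀ i → Prime (q i)) (q-injective : Injective _≡_ _≡_ q) where

  private
    s = prodOmit m q
    P = prodF (suc m) q
    E = sumF (suc m) s
    instance
      q-nonZero : ∀ {i} → NonZero (q i)
      q-nonZero = prime⇒nonZero (prime _)

  primeOmit-notRepresentable : ∀ c → sumF (suc m) (λ i → c i * s i) + E ≢ m * P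
  primeOmit-notRepresentable c Σcs+E≡mP = <⇒≱ (m<n+m (m * P) P>0) (begin
    suc m * P                             ≡⟨ sym (sumF-*prodOmit m q) ⟩
    sumF (suc m) (λ i → q i * s i)        ≤⟨ sumF-mono-≤ (suc m) (λ i → *-monoˡ-≤ (s i) (q≤1+c i)) ⟩
    sumF (suc m) (λ i → suc (c i) * s i)  ≡⟨ Σ[1+c]s≡mP ⟩
    m * P                                 ∎)
    where
    open ≤-Reasoning
    P>0 : 0 < P
    P>0 = prodF-positive (suc m) (<⇒≤ ∘ prime⇒≥2 ∘ prime)
    Σ[1+c]s≡mP : sumF (suc m) (λ i → suc (c i) * s i) ≡ m * P
    Σ[1+c]s≡mP = trans (sumF-+ (suc m) s (λ i → c i * s i)) (trans (+-comm E _) Σcs+E≡mP)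
    q∣[1+c]s : ∀ j → q j ∣ suc (c j) * s j
    q∣[1+c]s j = m%n≡0⇒n∣m _ (q j) (begin-equality
      (suc (c j) * s j) % q j                     ≡⟨ sym (sumF-*prodOmit-% m q (suc ∘ c) j) ⟩
      sumF (suc m) (λ i → suc (c i) * s i) % q j  ≡⟨ cong (_% q j) Σ[1+c]s≡mP ⟩
      (m * P) % q j                               ≡⟨ n∣m⇒m%n≡0 (m * P) (q j) qⱼ∣mP ⟩
      0                                           ∎)
      where
      qⱼ∣mP : q j ∣ m * P
      qⱼ∣mP = ∣-trans (∣prodF (suc m) q j) (n∣m*n m)
    q≤1+c : ∀ j → q j ≤ suc (c j)
    q≤1+c j with euclidsLemma (suc (c j)) (s j) (prime j) (q∣[1+c]s j)
    ... | inj₁ qⱼ∣1+cⱼ = ∣⇒≤ qⱼ∣1+cⱼ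
    ... | inj₂ qⱼ∣sⱼ   = ⊥-elim (∤prodOmit m prime q-injective j qⱼ∣sⱼ)

  primeOmit-representable : ∀ n → m * P < n + E → Representable (suc m) s (+ n)
  primeOmit-representable n mP<n+E = c′ , cong +_ n≡Σc′s
    where
    solution : ∀ i → ∃ λ c → c < q i × (c * s i) % q i ≡ n % q i
    solution i = ∃-solution-% (prime∤⇒coprime (prime i) (∤prodOmit m prime q-injective i)) n
    c : Fin (suc m) → ℕ
    c i = proj₁ (solution i)
    T : ℕ
    T = sumF (suc m) (λ i → c i * s i)
    T≡n : ∀ i → T % q i ≡ n % q i
    T≡n i = trans (sumF-*prodOmit-% m q c i) (proj₂ (proj₂ (solution i)))
    T<n+P : T < n + P
    T<n+P = +-cancelˡ-< E T (n + P) (begin-strict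
      E + T                                 ≡⟨ sym (sumF-+ (suc m) s (λ i → c i * s i)) ⟩
      sumF (suc m) (λ i → suc (c i) * s i)
        ≤⟨ sumF-mono-≤ (suc m) (λ i → *-monoˡ-≤ (s i) (proj₁ (proj₂ (solution i)))) ⟩
      sumF (suc m) (λ i → q i * s i)        ≡⟨ sumF-*prodOmit m q ⟩
      P + m * P                             <⟨ +-monoʳ-< P mP<n+E ⟩
      P + (n + E)                           ≡⟨ rotate P n E ⟩
      E + (n + P)                           ∎)
      where
      open ≤-Reasoning
      rotate : ∀ P n E → P + (n + E) ≡ E + (n + P)
      rotate = solve-∀
    T≤n : T ≤ n
    T≤n = ∣∸∧<⇒≤ (prodF-∣ (suc m) prime q-injective (λ i → %≡%⇒∣∸ n T (q i) (sym (T≡n i)))) T<n+P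
    P∣n∸T : P ∣ n ∸ T
    P∣n∸T = prodF-∣ (suc m) prime q-injective (λ i → %≡%⇒∣∸ T n (q i) (T≡n i))
    open _∣_ P∣n∸T renaming (quotient to k; equality to n∸T≡kP)
    c′ : Fin (suc m) → ℕ
    c′ zero    = c zero + k * q zero
    c′ (suc i) = c (suc i)
    n≡Σc′s : n ≡ sumF (suc m) (λ i → c′ i * s i)
    n≡Σc′s = begin
      n                                   ≡⟨ sym (m∸n+n≡m T≤n) ⟩
      n ∸ T + T                           ≡⟨ cong (_+ T) n∸T≡kP ⟩
      k * P + T
        ≡⟨ absorb k (q zero) (s zero) (c zero) (sumF m (λ i → c (suc i) * s (suc i))) ⟩
      sumF (suc m) (λ i → c′ i * s i)     ∎
      where
      open ≡-Reasoning
      absorb : ∀ k q₀ s₀ c₀ R → k * (q₀ * s₀) + (c₀ * s₀ + R) ≡ (c₀ + k * q₀) * s₀ + R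
      absorb = solve-∀

isFrobenius-primeOmit : ∀ m {q : Fin (suc (suc m)) → ℕ} → (∀ i → Prime (q i)) → Injective _≡_ _≡_ q →
                        IsFrobenius (suc (suc m)) (prodOmit (suc m) q) (frobeniusFormula (suc m) q)
isFrobenius-primeOmit m {q} prime q-injective =
  isFrobenius-⊖ {s = prodOmit (suc m) q} E≤mP (primeOmit-notRepresentable prime q-injective)
                                         (primeOmit-representable prime q-injective)
  where
  q≥2 : ∀ i → 2 ≤ q i
  q≥2 = prime⇒≥2 ∘ prime
  E≤mP : sumF (suc (suc m)) (prodOmit (suc m) q) ≤ suc m * prodF (suc (suc m)) q
  E≤mP = s≤s⁻¹ (subst (suc E ≤_) (conductor+sumF-prodOmit (suc m) (<⇒≤ ∘ q≥2))
                               (+-monoˡ-≤ E (conductor-positive m q≥2)))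
    where
    E = sumF (suc (suc m)) (prodOmit (suc m) q)

-- Strictly increasing index maps

strictlyIncreasing⇒injective : ∀ {n} {f : Fin n → ℕ} → (∀ i j → i <ᶠ j → f i < f j) → Injective _≡_ _≡_ f
strictlyIncreasing⇒injective f-mono {i} {j} fi≡fj with <ᶠ-cmp i j
... | tri< i<j _ _   = contradiction fi≡fj (<⇒≢ (f-mono i j i<j))
... | tri≈ _ i≡j _   = i≡j
... | tri> _ _ j<i   = contradiction (sym fi≡fj) (<⇒≢ (f-mono j i j<i))

strictlyIncreasing⇒monotone : ∀ {n} {f : Fin n → ℕ} → (∀ i j → i <ᶠ j → f i < f j) →
                              ∀ i j → toℕ i ≤ toℕ j → f i ≤ f j
strictlyIncreasing⇒monotone {f = f} f-mono i j i≤j with m≤n⇒m<n∨m≡n i≤j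
... | inj₁ i<j = <⇒≤ (f-mono i j i<j)
... | inj₂ i≡j = ≤-reflexive (cong f (toℕ-injective i≡j))

strictlyIncreasing-toℕ+k≤n+j : ∀ {n} k (ι : Fin (suc k) → Fin (suc n)) → (∀ a b → a <ᶠ b → ι a <ᶠ ι b) →
                               ∀ j → toℕ (ι j) + k ≤ n + toℕ j
strictlyIncreasing-toℕ+k≤n+j zero    ι ι-mono zero = +-monoˡ-≤ 0 (toℕ≤pred[n] (ι zero))
strictlyIncreasing-toℕ+k≤n+j {n} (suc k) ι ι-mono = bound
  where
  open ≤-Reasoning
  tail-bound : ∀ j → toℕ (ι (suc j)) + k ≤ n + toℕ j
  tail-bound = strictlyIncreasing-toℕ+k≤n+j k (ι ∘ suc) (λ a b → ι-mono (suc a) (suc b) ∘ s≤s)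
  bound : ∀ j → toℕ (ι j) + suc k ≤ n + toℕ j
  bound zero = begin
    toℕ (ι zero) + suc k      ≡⟨ +-suc (toℕ (ι zero)) k ⟩
    suc (toℕ (ι zero)) + k    ≤⟨ +-monoˡ-≤ k (ι-mono zero (suc zero) (s≤s z≤n)) ⟩
    toℕ (ι (suc zero)) + k    ≤⟨ tail-bound zero ⟩
    n + 0                     ∎
  bound (suc j) = begin
    toℕ (ι (suc j)) + suc k   ≡⟨ +-suc (toℕ (ι (suc j))) k ⟩
    suc (toℕ (ι (suc j)) + k) ≤⟨ s≤s (tail-bound j) ⟩
    suc (n + toℕ j)           ≡⟨ sym (+-suc n (toℕ j)) ⟩
    n + suc (toℕ j)           ∎

module _ {n k} (k≤n : k ≤ n) where

  private
    top = topIdx n k k≤n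

  toℕ-topIdx : ∀ j → toℕ (top j) ≡ n ∸ k + toℕ j
  toℕ-topIdx j = toℕ-fromℕ< _

  topIdx-strictlyIncreasing : ∀ a b → a <ᶠ b → top a <ᶠ top b
  topIdx-strictlyIncreasing a b a<b =
    subst₂ _<_ (sym (toℕ-topIdx a)) (sym (toℕ-topIdx b)) (+-monoʳ-< (n ∸ k) a<b)

  strictlyIncreasing-≤-topIdx : (ι : Fin (suc k) → Fin (suc n)) → (∀ a b → a <ᶠ b → ι a <ᶠ ι b) →
                                ∀ j → toℕ (ι j) ≤ toℕ (top j)
  strictlyIncreasing-≤-topIdx ι ι-mono j = +-cancelʳ-≤ k _ _ (begin
    toℕ (ι j) + k          ≤⟨ strictlyIncreasing-toℕ+k≤n+j k ι ι-mono j ⟩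
    n + toℕ j              ≡⟨ cong (_+ toℕ j) (sym (m∸n+n≡m k≤n)) ⟩
    n ∸ k + k + toℕ j      ≡⟨ +-right-comm (n ∸ k) k (toℕ j) ⟩
    n ∸ k + toℕ j + k      ≡⟨ cong (_+ k) (sym (toℕ-topIdx j)) ⟩
    toℕ (top j) + k        ∎)
    where
    open ≤-Reasoning
    +-right-comm : ∀ a b c → a + b + c ≡ a + c + b
    +-right-comm = solve-∀

frobeniusFormula-topIdx-maximal :
  ∀ {n} {p : Fin (suc n) → ℕ} → (∀ i → 2 ≤ p i) → (∀ i j → i <ᶠ j → p i < p j) →
  ∀ k (k≤n : suc k ≤ n) (ι : Fin (suc (suc k)) → Fin (suc n)) → (∀ a b → a <ᶠ b → ι a <ᶠ ι b) →
  frobeniusFormula (suc k) (p ∘ ι) ≤ℤ frobeniusFormula (suc k) (p ∘ topIdx n (suc k) k≤n) ×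
  (frobeniusFormula (suc k) (p ∘ topIdx n (suc k) k≤n) ≡ frobeniusFormula (suc k) (p ∘ ι) ⇔
   (∀ j → toℕ (ι j) ≡ n ∸ suc k + toℕ j))
frobeniusFormula-topIdx-maximal {n} {p} p≥2 p-mono k k≤n ι ι-mono =
  frobeniusFormula-mono-≤ (suc k) (<⇒≤ ∘ p≥2 ∘ ι) pι≤ptop , mk⇔ equal⇒top top⇒equal
  where
  top = topIdx n (suc k) k≤n
  ι≤top : ∀ j → toℕ (ι j) ≤ toℕ (top j)
  ι≤top = strictlyIncreasing-≤-topIdx k≤n ι ι-mono
  pι≤ptop : ∀ j → p (ι j) ≤ p (top j)
  pι≤ptop j = strictlyIncreasing⇒monotone p-mono (ι j) (top j) (ι≤top j)
  equal⇒top : frobeniusFormula (suc k) (p ∘ top) ≡ frobeniusFormula (suc k) (p ∘ ι) →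
              ∀ j → toℕ (ι j) ≡ n ∸ suc k + toℕ j
  equal⇒top g₁≡g₂ j with m≤n⇒m<n∨m≡n (ι≤top j)
  ... | inj₁ ιⱼ<topⱼ = contradiction (sym g₁≡g₂)
          (ℤ.<⇒≢ (frobeniusFormula-mono-< k (p≥2 ∘ ι) pι≤ptop j (p-mono (ι j) (top j) ιⱼ<topⱼ)))
  ... | inj₂ ιⱼ≡topⱼ = trans ιⱼ≡topⱼ (toℕ-topIdx k≤n j)
  top⇒equal : (∀ j → toℕ (ι j) ≡ n ∸ suc k + toℕ j) →
              frobeniusFormula (suc k) (p ∘ top) ≡ frobeniusFormula (suc k) (p ∘ ι)
  top⇒equal ι≡top = ℤ.≤-antisym
    (frobeniusFormula-mono-≤ (suc k) (<⇒≤ ∘ p≥2 ∘ top)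
      (λ j → ≤-reflexive (cong p (toℕ-injective (trans (toℕ-topIdx k≤n j) (sym (ι≡top j)))))))
    (frobeniusFormula-mono-≤ (suc k) (<⇒≤ ∘ p≥2 ∘ ι) pι≤ptop)

lemma2p3 : (n : ℕ) → 1 ≤ n → (p : Fin (suc n) → ℕ) → ((i : Fin (suc n)) → Prime (p i))
    → ((i j : Fin (suc n)) → i <ᶠ j → p i < p j)
    → IsFrobenius (suc n) (prodOmit n p)
        (+ (n * prodF (suc n) p) - + sumF (suc n) (prodOmit n p))
      × ((k : ℕ) → 1 ≤ k → (k≤n : k ≤ n) → (ι : Fin (suc k) → Fin (suc n))
          → ((a b : Fin (suc k)) → a <ᶠ b → ι a <ᶠ ι b)
          → Σ ℤ (λ g₁ → Σ ℤ (λ g₂ →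
              IsFrobenius (suc k) (prodOmit k (λ j → p (topIdx n k k≤n j))) g₁
              × IsFrobenius (suc k) (prodOmit k (λ j → p (ι j))) g₂
              × g₂ ≤ℤ g₁
              × (g₁ ≡ g₂ ⇔ ((j : Fin (suc k)) → toℕ (ι j) ≡ (n ∸ k) + toℕ j)))))
lemma2p3 (suc d) _ p prime p-mono =
  isFrobenius-primeOmit d prime (strictlyIncreasing⇒injective p-mono) ,
  λ where
    (suc e) _ k≤n ι ι-mono →
      _ , _ ,
      isFrobenius-primeOmit e (prime ∘ topIdx _ _ k≤n)
        (strictlyIncreasing⇒injective (λ a b → p-mono _ _ ∘ topIdx-strictlyIncreasing k≤n a b)) ,
      isFrobenius-primeOmit e (prime ∘ ι)
        (strictlyIncreasing⇒injective (λ a b → p-mono _ _ ∘ ι-mono a b)) ,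
      frobeniusFormula-topIdx-maximal (prime⇒≥2 ∘ prime) p-mono e k≤n ι ι-mono
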